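{- If $T_1,\dots,T_k$ are trees each of order at least three, then $$\mu_t(T_1\Box \cdots \Box T_k)=\prod_{i=1}^k{\rm n}_1(T_i).$$
   Context: ${\rm n}_1(T)$ denotes the number of leaves of a tree $T$. The Cartesian product $G\Box H$ has vertex set $V(G)\times V(H)$, with $(x,y)$ adjacent to $(x',y')$ iff either $x=x'$ and $yy'\in E(H)$, or $xx'\in E(G)$ and $y=y'$. For a graph $F$ and $X\subseteq V(F)$, two vertices $x,y$ are $X$-visible if there is a shortest $x,y$-path in $F$ none of whose internal vertices lies in $X$. $X$ is a total mutual-visibility set of $F$ if every two vertices of $F$ are $X$-visible; $\mu_t(F)$ is the maximum cardinality of such a set. -}

module Defs where

open import Data.Nat using (ℕ; zero; suc; _*_; _+_; _≤_; _<_; _≡ᵇ_)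
open import Data.Bool using (Bool; true; false; _∧_; _∨_; if_then_else_)
open import Data.Fin using (Fin; zero; suc; toℕ; inject₁; remQuot; _≟_)
open import Data.Fin.Subset using (Subset; _∉_; ∣_∣)
open import Data.Vec using (Vec; []; _∷_; lookup; head; last)
open import Data.Product using (Σ; _×_; _,_; ∃)
open import Relation.Binary.PropositionalEquality using (_≡_; _≢_)
open import Relation.Nullary using (¬_)
open import Relation.Nullary.Decidable using (⌊_⌋)

record Graph : Set where
  constructor mkGraph
  field
    order : ℕ
    adj   : Fin order → Fin order → Bool
open Graph public

Vertex : Graph → Set
Vertex G = Fin (order G)

Adj : (G : Graph) → Vertex G → Vertex G → Set
Adj G u v = adj G u v ≡ true

IsSimple : Graph → Set
IsSimple G = (∀ u v → adj G u v ≡ adj G v u) × (∀ u → adj G u u ≡ false)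

record Walk (G : Graph) (x y : Vertex G) (ℓ : ℕ) : Set where
  field
    vs    : Vec (Vertex G) (suc ℓ)
    start : head vs ≡ x
    end   : last vs ≡ y
    steps : ∀ (i : Fin ℓ) → Adj G (lookup vs (inject₁ i)) (lookup vs (suc i))
open Walk public

Connected : Graph → Set
Connected G = ∀ (x y : Vertex G) → ∃ λ ℓ → Walk G x y ℓ

HasCycle : Graph → Set
HasCycle G = Σ (Vertex G) λ x → Σ ℕ λ m → Σ (Walk G x x m) λ w →
  (3 ≤ m) × (∀ (i j : Fin m) → lookup (vs w) (inject₁ i) ≡ lookup (vs w) (inject₁ j) → i ≡ j)

IsTree : Graph → Set
IsTree G = IsSimple G × Connected G × ¬ HasCycle G

countF : ∀ {n} → (Fin n → Bool) → ℕ
countF {zero}  p = 0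
countF {suc n} p = (if p zero then 1 else 0) + countF (λ i → p (suc i))

degree : (G : Graph) → Vertex G → ℕ
degree G v = countF (adj G v)

n₁ : Graph → ℕ
n₁ G = countF (λ v → degree G v ≡ᵇ 1)

-- Cartesian product G □ H, vertex set Fin (|G| * |H|) ≅ V(G) × V(H) via remQuot
adj□ : (G H : Graph) → Fin (order G * order H) → Fin (order G * order H) → Bool
adj□ G H p q with remQuot (order H) p | remQuot (order H) q
... | (a , b) | (a' , b') = (⌊ a ≟ a' ⌋ ∧ adj H b b') ∨ (adj G a a' ∧ ⌊ b ≟ b' ⌋)

_□_ : Graph → Graph → Graph
G □ H = mkGraph (order G * order H) (adj□ G H)

□-all : ∀ {k} → Vec Graph (suc k) → Graph
□-all (G ∷ [])      = G
□-all (G ∷ H ∷ Gs)  = G □ □-all (H ∷ Gs)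

prod : ∀ {k} → Vec ℕ k → ℕ
prod []       = 1
prod (x ∷ xs) = x * prod xs

IsShortest : (G : Graph) {x y : Vertex G} {ℓ : ℕ} → Walk G x y ℓ → Set
IsShortest G {x} {y} {ℓ} _ = ∀ ℓ' → ℓ' < ℓ → ¬ Walk G x y ℓ'

Visible : (G : Graph) → Subset (order G) → Vertex G → Vertex G → Set
Visible G X x y = Σ ℕ λ ℓ → Σ (Walk G x y ℓ) λ w → IsShortest G w ×
  (∀ (i : Fin (suc ℓ)) → 0 < toℕ i → toℕ i < ℓ → lookup (vs w) i ∉ X)

IsTotalMutualVisibilitySet : (G : Graph) → Subset (order G) → Set
IsTotalMutualVisibilitySet G X = ∀ (x y : Vertex G) → Visible G X x y

μt≡ : Graph → ℕ → Set
μt≡ G m = (Σ (Subset (order G)) λ X → IsTotalMutualVisibilitySet G X × ∣ X ∣ ≡ m)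
        × (∀ X → IsTotalMutualVisibilitySet G X → ∣ X ∣ ≤ m)

{-# OPTIONS --safe #-}
-- In a tree with at least three vertices no two leaves are adjacent, inner vertices of
-- shortest paths are never leaves, and every non-leaf v has two neighbours u, w whose only
-- common neighbour is v (there are no 3- or 4-cycles), so v is the middle of the unique
-- shortest u,w-path and lies in no total mutual-visibility set.  Call a vertex set with
-- these three properties tight: a tight set is then the largest total mutual-visibility set.
-- Tightness passes from S ⊆ V(G) and S' ⊆ V(H) to S × S' ⊆ V(G □ H), because a shortest path
-- of G □ H can be assembled from shortest paths of G and H, turning at a vertex outside
-- S × S'; independence of S is what makes the turn possible when both factor paths are
-- single edges.  So μ_t of the product is the number of vertices all of whose coordinates
-- are leaves.
module Submission where

open import Defs
open import Data.Bool using (Bool; true; false; _∧_; _∨_; if_then_else_) renaming (_≟_ to _≟ᵇ_)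
open import Data.Bool.Properties using (T-≡; ∨-zeroʳ; ∧-zeroʳ; ∧-conicalˡ; ∧-conicalʳ)
open import Data.Empty using (⊥; ⊥-elim)
open import Data.Fin using (Fin; zero; suc; toℕ; inject₁; remQuot; combine; _≟_; _↑ˡ_; _↑ʳ_)
open import Data.Fin.Properties using (remQuot-combine; combine-remQuot; combine-injective; suc-injective; any?)
open import Data.Fin.Subset using (Subset; _∈_; _∉_; ∣_∣)
open import Data.Nat using (ℕ; zero; suc; _+_; _*_; _≤_; _<_; z≤n; s≤s; s≤s⁻¹; z<s; s<s; _≡ᵇ_)
open import Data.Nat.Properties
  using (≡ᵇ⇒≡; ≤-trans; m≤n+m; n≤1+n; 1+n≰n; ≮⇒≥; <⇒≱; +-mono-≤; +-comm; +-suc; +-assoc; +-identityʳ; *-identityʳ; *-distribʳ-+)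
open import Data.Product using (Σ; ∃; ∃₂; _×_; _,_; proj₁; proj₂; uncurry; map₁; map₂)
open import Data.Sum as Sum using (_⊎_; inj₁; inj₂; [_,_]′)
open import Data.Unit using (⊤; tt)
open import Data.Vec using (Vec; []; _∷_; lookup; head; last; tabulate; map)
open import Data.Vec.Properties using (lookup∘tabulate; []=⇒lookup; lookup⇒[]=)
open import Data.Vec.Relation.Unary.All using ([]; _∷_)
open import Data.Vec.Relation.Unary.AllPairs using ([]; _∷_)
open import Data.Vec.Relation.Unary.Unique.Propositional using (Unique)
open import Data.Vec.Relation.Unary.Unique.Propositional.Properties using (lookup-injective)
open import Function using (_∘_; Equivalence)
open import Relation.Binary.PropositionalEquality using (_≡_; _≢_; refl; sym; trans; cong; cong₂; subst; subst₂; module ≡-Reasoning)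
open import Relation.Nullary using (¬_; Dec; yes; no)
open import Relation.Nullary.Decidable using (⌊_⌋; _×-dec_; toWitness; fromWitness)
open import Relation.Unary using (Decidable)

private variable
  G H : Graph
  ℓ m n : ℕ

data Steps (G : Graph) : Vertex G → Vertex G → ℕ → Set where
  ε   : ∀ {x} → Steps G x x 0
  _◅_ : ∀ {x y z ℓ} → Adj G x y → Steps G y z ℓ → Steps G x z (suc ℓ)

infixr 5 _◅_ _◅◅_

_◅◅_ : ∀ {x y z} → Steps G x y m → Steps G y z n → Steps G x z (m + n)
ε       ◅◅ v = v
(a ◅ u) ◅◅ v = a ◅ (u ◅◅ v)

Geodesic : (G : Graph) {x y : Vertex G} {ℓ : ℕ} → Steps G x y ℓ → Set
Geodesic G {x} {y} {ℓ} _ = ∀ {m} → m < ℓ → ¬ Steps G x y m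

geodesic-≤ : ∀ {x y} (w : Steps G x y ℓ) → Geodesic G w → Steps G x y m → ℓ ≤ m
geodesic-≤ _ geo v = ≮⇒≥ (λ m<ℓ → geo m<ℓ v)

geodesic-tail : ∀ {x y z} (a : Adj G x y) (w : Steps G y z ℓ) → Geodesic G (a ◅ w) → Geodesic G w
geodesic-tail a _ geo m<ℓ v = geo (s≤s m<ℓ) (a ◅ v)

AllButLast : (P : Vertex G → Set) {x y : Vertex G} → Steps G x y ℓ → Set
AllButLast P ε             = ⊤
AllButLast P (_◅_ {x} _ w) = P x × AllButLast P w

Interior : (P : Vertex G → Set) {x y : Vertex G} → Steps G x y ℓ → Set
Interior P ε       = ⊤
Interior P (_ ◅ w) = AllButLast P w

module _ {P Q : Vertex G → Set} where

  allButLast-map : (∀ v → P v → Q v) → ∀ {x y} (w : Steps G x y ℓ) → AllButLast P w → AllButLast Q w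
  allButLast-map f ε             _        = tt
  allButLast-map f (_◅_ {x} _ w) (p , ps) = f x p , allButLast-map f w ps

  interior-map : (∀ v → P v → Q v) → ∀ {x y} (w : Steps G x y ℓ) → Interior P w → Interior Q w
  interior-map f ε       _  = tt
  interior-map f (_ ◅ w) ps = allButLast-map f w ps

allButLast-all : {P : Vertex G → Set} → (∀ v → P v) → ∀ {x y} (w : Steps G x y ℓ) → AllButLast P w
allButLast-all p ε             = tt
allButLast-all p (_◅_ {x} _ w) = p x , allButLast-all p w

allButLast-◅◅ : {P : Vertex G → Set} {x y z : Vertex G} (u : Steps G x y m) (v : Steps G y z n) →
                AllButLast P u → AllButLast P v → AllButLast P (u ◅◅ v)
allButLast-◅◅ ε       v _         pv = pv
allButLast-◅◅ (_ ◅ u) v (p , pu) pv = p , allButLast-◅◅ u v pu pv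

Visibleˢ : (G : Graph) → (Vertex G → Set) → Vertex G → Vertex G → Set
Visibleˢ G P x y = ∃₂ λ ℓ (w : Steps G x y ℓ) → Geodesic G w × Interior P w

Outside : {A : Set} → (A → Bool) → A → Set
Outside S v = S v ≡ false

arrivals : ∀ {x y} → Steps G x y ℓ → Vec (Vertex G) ℓ
arrivals ε                 = []
arrivals (_◅_ {y = y} _ w) = y ∷ arrivals w

vertices : ∀ {x y} → Steps G x y ℓ → Vec (Vertex G) (suc ℓ)
vertices {x = x} w = x ∷ arrivals w

departures : ∀ {x y} → Steps G x y ℓ → Vec (Vertex G) ℓ
departures ε             = []
departures (_◅_ {x} _ w) = x ∷ departures w

last-vertices : ∀ {x y} (w : Steps G x y ℓ) → last (vertices w) ≡ y
last-vertices ε               = refl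
last-vertices (_ ◅ ε)         = refl
last-vertices (_ ◅ w@(_ ◅ _)) = last-vertices w

vertices-adjacent : ∀ {x y} (w : Steps G x y ℓ) (i : Fin ℓ) →
                    Adj G (lookup (vertices w) (inject₁ i)) (lookup (vertices w) (suc i))
vertices-adjacent (a ◅ _) zero    = a
vertices-adjacent (_ ◅ w) (suc i) = vertices-adjacent w i

lookup-departures : ∀ {x y} (w : Steps G x y ℓ) (i : Fin ℓ) →
                    lookup (vertices w) (inject₁ i) ≡ lookup (departures w) i
lookup-departures (_ ◅ w) zero    = refl
lookup-departures (_ ◅ w) (suc i) = lookup-departures w i

toWalk : ∀ {x y} → Steps G x y ℓ → Walk G x y ℓ
toWalk w = record { vs = vertices w ; start = refl ; end = last-vertices w ; steps = vertices-adjacent w }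

fromVertices : (G : Graph) (v : Vec (Vertex G) (suc ℓ)) → (∀ i → Adj G (lookup v (inject₁ i)) (lookup v (suc i))) →
               Steps G (head v) (last v) ℓ
fromVertices {ℓ = zero}  G (x ∷ [])    _   = ε
fromVertices {ℓ = suc ℓ} G (x ∷ y ∷ v) adj = adj zero ◅ fromVertices G (y ∷ v) (adj ∘ suc)

fromWalk : ∀ {x y} → Walk G x y ℓ → Steps G x y ℓ
fromWalk record { vs = v ; start = refl ; end = refl ; steps = adj } = fromVertices _ v adj

allButLast-lookup : {P : Vertex G → Set} {x y : Vertex G} (w : Steps G x y ℓ) → AllButLast P w →
                    ∀ i → toℕ i < ℓ → P (lookup (vertices w) i)
allButLast-lookup (_ ◅ w) (p , _)  zero    _         = p
allButLast-lookup (_ ◅ w) (_ , ps) (suc i) (s≤s i<ℓ) = allButLast-lookup w ps i i<ℓ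

allButLast-fromVertices : (G : Graph) {P : Vertex G → Set} (v : Vec (Vertex G) (suc ℓ)) → ∀ adj →
                          (∀ i → toℕ i < ℓ → P (lookup v i)) → AllButLast P (fromVertices G v adj)
allButLast-fromVertices {ℓ = zero}  G (x ∷ [])    adj p = tt
allButLast-fromVertices {ℓ = suc ℓ} G (x ∷ y ∷ v) adj p =
  p zero z<s , allButLast-fromVertices G (y ∷ v) (adj ∘ suc) (λ i i<ℓ → p (suc i) (s<s i<ℓ))

interior-fromWalk : {P : Vertex G → Set} {x y : Vertex G} (w : Walk G x y ℓ) →
                    (∀ i → 0 < toℕ i → toℕ i < ℓ → P (lookup (vs w) i)) → Interior P (fromWalk w)
interior-fromWalk {ℓ = zero}  record { vs = x ∷ []    ; start = refl ; end = refl } p = tt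
interior-fromWalk {ℓ = suc ℓ} record { vs = x ∷ y ∷ v ; start = refl ; end = refl ; steps = adj } p =
  allButLast-fromVertices _ (y ∷ v) (adj ∘ suc) (λ i i<ℓ → p (suc i) z<s (s<s i<ℓ))

visibleˢ⇒visible : ∀ {X : Subset (order G)} {x y : Vertex G} → Visibleˢ G (_∉ X) x y → Visible G X x y
visibleˢ⇒visible {G = G} {X = X} (ℓ , w , geo , int) =
  ℓ , toWalk w , (λ _ m<ℓ v → geo m<ℓ (fromWalk v)) , interior-lookup w int
  where
  interior-lookup : ∀ {x y ℓ} (w : Steps G x y ℓ) → Interior (_∉ X) w →
                    ∀ i → 0 < toℕ i → toℕ i < ℓ → lookup (vertices w) i ∉ X
  interior-lookup (_ ◅ w) int (suc i) _ (s≤s i<ℓ) = allButLast-lookup w int i i<ℓ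

visible⇒visibleˢ : {X : Subset (order G)} {x y : Vertex G} → Visible G X x y → Visibleˢ G (_∉ X) x y
visible⇒visibleˢ (ℓ , w , shortest , int) =
  ℓ , fromWalk w , (λ {m} m<ℓ v → shortest m m<ℓ (toWalk v)) , interior-fromWalk w int

steps? : (G : Graph) (x y : Vertex G) (ℓ : ℕ) → Dec (Steps G x y ℓ)
steps? G x y zero with x ≟ y
... | yes refl = yes ε
... | no x≢y   = no λ { ε → x≢y refl }
steps? G x y (suc ℓ) with any? (λ z → (adj G x z ≟ᵇ true) ×-dec steps? G z y ℓ)
... | yes (z , a , w) = yes (a ◅ w)
... | no ∄z           = no λ { (a ◅ w) → ∄z (_ , a , w) }

least : {P : ℕ → Set} → Decidable P → ∀ {n} → P n → ∃ λ m → P m × (∀ {k} → k < m → ¬ P k)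
least P? p with P? 0
... | yes p₀ = 0 , p₀ , λ ()
least P? {zero}  p | no ¬p₀ = ⊥-elim (¬p₀ p)
least P? {suc n} p | no ¬p₀ with least (P? ∘ suc) p
... | m , pm , minimal = suc m , pm , λ { {zero} _ → ¬p₀ ; {suc k} k<m → minimal (s≤s⁻¹ k<m) }

geodesic : ∀ {x y} → Steps G x y ℓ → ∃₂ λ m (w : Steps G x y m) → Geodesic G w
geodesic {G = G} {x = x} {y = y} = least (steps? G x y)

UniqueMiddle : (G : Graph) → Vertex G → Set
UniqueMiddle G v = Σ (Vertex G) λ u → Σ (Vertex G) λ w →
  u ≢ w × ¬ Adj G u w × Adj G u v × Adj G v w × (∀ c → Adj G u c → Adj G c w → c ≡ v)

uniqueMiddle-∉ : ∀ {v} {X : Subset (order G)} → UniqueMiddle G v → IsTotalMutualVisibilitySet G X → v ∉ X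
uniqueMiddle-∉ {X = X} (u , w , u≢w , ¬uw , uv , vw , unique) tmv v∈X with visible⇒visibleˢ (tmv u w)
... | _ , ε , _                    = u≢w refl
... | _ , a ◅ ε , _                = ¬uw a
... | _ , a ◅ b ◅ ε , _ , c∉X , _  = c∉X (subst (_∈ X) (sym (unique _ a b)) v∈X)
... | _ , _ ◅ _ ◅ _ ◅ _ , geo , _  = geo (s≤s (s≤s (s≤s z≤n))) (uv ◅ vw ◅ ε)

countF-cong : {p q : Fin n → Bool} → (∀ i → p i ≡ q i) → countF p ≡ countF q
countF-cong {zero}  _   = refl
countF-cong {suc n} p≗q = cong₂ (λ b c → (if b then 1 else 0) + c) (p≗q zero) (countF-cong (p≗q ∘ suc))

countF-mono : {p q : Fin n → Bool} → (∀ i → p i ≡ true → q i ≡ true) → countF p ≤ countF q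
countF-mono {zero}          _   = z≤n
countF-mono {suc n} {p} {q} p⊆q with p zero in p₀ | q zero in q₀
... | true  | true  = s≤s (countF-mono (p⊆q ∘ suc))
... | false | true  = ≤-trans (countF-mono (p⊆q ∘ suc)) (n≤1+n _)
... | false | false = countF-mono (p⊆q ∘ suc)
... | true  | false with () ← trans (sym (p⊆q zero p₀)) q₀

countF-≥1 : (p : Fin n → Bool) {i : Fin n} → p i ≡ true → 1 ≤ countF p
countF-≥1 p {zero}  pᵢ rewrite pᵢ = s≤s z≤n
countF-≥1 p {suc i} pᵢ = ≤-trans (countF-≥1 (p ∘ suc) pᵢ) (m≤n+m _ _)

countF-≥2 : (p : Fin n → Bool) {i j : Fin n} → i ≢ j → p i ≡ true → p j ≡ true → 2 ≤ countF p
countF-≥2 p {zero}  {zero}  i≢j _  _  = ⊥-elim (i≢j refl)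
countF-≥2 p {zero}  {suc j} _   pᵢ pⱼ rewrite pᵢ = s≤s (countF-≥1 (p ∘ suc) pⱼ)
countF-≥2 p {suc i} {zero}  _   pᵢ pⱼ rewrite pⱼ = s≤s (countF-≥1 (p ∘ suc) pᵢ)
countF-≥2 p {suc i} {suc j} i≢j pᵢ pⱼ = ≤-trans (countF-≥2 (p ∘ suc) (i≢j ∘ cong suc) pᵢ pⱼ) (m≤n+m _ _)

countF≥1⇒∃ : (p : Fin n → Bool) → 1 ≤ countF p → ∃ λ i → p i ≡ true
countF≥1⇒∃ {suc n} p 1≤ with p zero in p₀
... | true  = zero , p₀
... | false = let i , pᵢ = countF≥1⇒∃ (p ∘ suc) 1≤ in suc i , pᵢ

countF≥2⇒∃₂ : (p : Fin n → Bool) → 2 ≤ countF p → ∃₂ λ i j → i ≢ j × p i ≡ true × p j ≡ true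
countF≥2⇒∃₂ {suc n} p 2≤ with p zero in p₀
... | true  = let j , pⱼ = countF≥1⇒∃ (p ∘ suc) (s≤s⁻¹ 2≤) in zero , suc j , (λ ()) , p₀ , pⱼ
... | false = let i , j , i≢j , pᵢ , pⱼ = countF≥2⇒∃₂ (p ∘ suc) 2≤ in
              suc i , suc j , i≢j ∘ suc-injective , pᵢ , pⱼ

countF≡1⇒unique : (p : Fin n → Bool) → countF p ≡ 1 → ∀ {i j} → p i ≡ true → p j ≡ true → i ≡ j
countF≡1⇒unique p count≡1 {i} {j} pᵢ pⱼ with i ≟ j
... | yes i≡j = i≡j
... | no  i≢j = ⊥-elim (1+n≰n (subst (2 ≤_) count≡1 (countF-≥2 p i≢j pᵢ pⱼ)))

countF-↑ : ∀ m {n} (p : Fin (m + n) → Bool) → countF p ≡ countF (p ∘ (_↑ˡ n)) + countF (p ∘ (m ↑ʳ_))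
countF-↑ zero    p = refl
countF-↑ (suc m) p =
  trans (cong ((if p zero then 1 else 0) +_) (countF-↑ m (p ∘ suc))) (sym (+-assoc (if p zero then 1 else 0) _ _))

countF-∧ˡ : ∀ b (q : Fin n → Bool) → countF (λ j → b ∧ q j) ≡ (if b then 1 else 0) * countF q
countF-∧ˡ true  q = sym (+-identityʳ (countF q))
countF-∧ˡ {n} false q = countF-false {n}
  where
  countF-false : ∀ {n} → countF {n} (λ _ → false) ≡ 0
  countF-false {zero}  = refl
  countF-false {suc n} = countF-false {n}

countF-combine : ∀ m n {r : Fin (m * n) → Bool} (p : Fin m → Bool) (q : Fin n → Bool) →
                 (∀ i j → r (combine i j) ≡ p i ∧ q j) → countF r ≡ countF p * countF q
countF-combine zero    n p q r≗ = refl
countF-combine (suc m) n {r} p q r≗ = begin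
  countF r
    ≡⟨ countF-↑ n r ⟩
  countF (r ∘ (_↑ˡ m * n)) + countF (r ∘ (n ↑ʳ_))
    ≡⟨ cong₂ _+_ (countF-cong (r≗ zero)) (countF-combine m n (p ∘ suc) q (r≗ ∘ suc)) ⟩
  countF (λ j → p zero ∧ q j) + countF (p ∘ suc) * countF q
    ≡⟨ cong (_+ countF (p ∘ suc) * countF q) (countF-∧ˡ (p zero) q) ⟩
  (if p zero then 1 else 0) * countF q + countF (p ∘ suc) * countF q
    ≡⟨ *-distribʳ-+ (countF q) (if p zero then 1 else 0) _ ⟨
  countF p * countF q
    ∎
  where open ≡-Reasoning

∣∣≡countF : (X : Subset n) → ∣ X ∣ ≡ countF (lookup X)
∣∣≡countF []          = refl
∣∣≡countF (true ∷ X)  = cong suc (∣∣≡countF X)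
∣∣≡countF (false ∷ X) = ∣∣≡countF X

record Tight (G : Graph) (S : Vertex G → Bool) : Set where
  field
    visible     : ∀ x y → Visibleˢ G (Outside S) x y
    independent : ∀ {x y} → Adj G x y → S x ≡ true → S y ≡ true → ⊥
    middle      : ∀ {v} → Outside S v → UniqueMiddle G v
open Tight

tight⇒μt≡ : ∀ {S} → Tight G S → μt≡ G (countF S)
tight⇒μt≡ {G = G} {S = S} tight = (tabulate S , tmv , card) , bound
  where
  ∉tabulate : ∀ v → Outside S v → v ∉ tabulate S
  ∉tabulate v out v∈ with () ← trans (sym out) (trans (sym (lookup∘tabulate S v)) ([]=⇒lookup v∈))

  tmv : IsTotalMutualVisibilitySet G (tabulate S)
  tmv x y = let ℓ , w , geo , int = visible tight x y in
            visibleˢ⇒visible (ℓ , w , geo , interior-map ∉tabulate w int)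

  card : ∣ tabulate S ∣ ≡ countF S
  card = trans (∣∣≡countF (tabulate S)) (countF-cong (lookup∘tabulate S))

  bound : ∀ X → IsTotalMutualVisibilitySet G X → ∣ X ∣ ≤ countF S
  bound X tmvX = subst (_≤ countF S) (sym (∣∣≡countF X)) (countF-mono X⊆S)
    where
    X⊆S : ∀ v → lookup X v ≡ true → S v ≡ true
    X⊆S v v∈X with S v in Sv
    ... | true  = refl
    ... | false = ⊥-elim (uniqueMiddle-∉ (middle tight Sv) tmvX (lookup⇒[]= v X v∈X))

∧∨∧≡true⁻ : ∀ {a b c d} → (a ∧ b) ∨ (c ∧ d) ≡ true → (a ≡ true × b ≡ true) ⊎ (c ≡ true × d ≡ true)
∧∨∧≡true⁻ {true}  {true}                      _  = inj₁ (refl , refl)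
∧∨∧≡true⁻ {true}  {false} {c = true} {true}  _  = inj₂ (refl , refl)
∧∨∧≡true⁻ {false}         {c = true} {true}  _  = inj₂ (refl , refl)
∧∨∧≡true⁻ {true}  {false} {c = true} {false} ()
∧∨∧≡true⁻ {true}  {false} {c = false}        ()
∧∨∧≡true⁻ {false}         {c = true} {false} ()
∧∨∧≡true⁻ {false}         {c = false}        ()

∧∨∧≡true⁺ : ∀ {a b c d} → (a ≡ true × b ≡ true) ⊎ (c ≡ true × d ≡ true) → (a ∧ b) ∨ (c ∧ d) ≡ true
∧∨∧≡true⁺         (inj₁ (refl , refl)) = refl
∧∨∧≡true⁺ {a} {b} (inj₂ (refl , refl)) = ∨-zeroʳ (a ∧ b)

⌊⌋≡true⁻ : ∀ {A : Set} (a? : Dec A) → ⌊ a? ⌋ ≡ true → A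
⌊⌋≡true⁻ a? = toWitness ∘ Equivalence.from T-≡

⌊⌋≡true⁺ : ∀ {A : Set} (a? : Dec A) → A → ⌊ a? ⌋ ≡ true
⌊⌋≡true⁺ a? = Equivalence.to T-≡ ∘ fromWitness

module Product (G H : Graph) where

  ⟨_,_⟩ : Vertex G → Vertex H → Vertex (G □ H)
  ⟨ a , b ⟩ = combine a b

  split : Vertex (G □ H) → Vertex G × Vertex H
  split = remQuot (order H)

  by-components : {P : Vertex (G □ H) → Set} → (∀ a b → P ⟨ a , b ⟩) → ∀ p → P p
  by-components {P} f p =
    subst P (combine-remQuot {order G} (order H) p) (f (proj₁ (split p)) (proj₂ (split p)))

  AdjCases : Vertex G × Vertex H → Vertex G × Vertex H → Set
  AdjCases (a , b) (a' , b') = (a ≡ a' × Adj H b b') ⊎ (Adj G a a' × b ≡ b')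

  fst : Vertex (G □ H) → Vertex G
  fst = proj₁ ∘ split

  snd : Vertex (G □ H) → Vertex H
  snd = proj₂ ∘ split

  adj-□⁻ : ∀ {p q} → Adj (G □ H) p q → AdjCases (split p) (split q)
  adj-□⁻ {p} {q} = Sum.map (map₁ (⌊⌋≡true⁻ (fst p ≟ fst q))) (map₂ (⌊⌋≡true⁻ (snd p ≟ snd q))) ∘ ∧∨∧≡true⁻

  adj-□⁺ : ∀ {p q} → AdjCases (split p) (split q) → Adj (G □ H) p q
  adj-□⁺ {p} {q} =
    ∧∨∧≡true⁺ {⌊ fst p ≟ fst q ⌋} {adj H (snd p) (snd q)} {adj G (fst p) (fst q)} {⌊ snd p ≟ snd q ⌋}
    ∘ Sum.map (map₁ (⌊⌋≡true⁺ (fst p ≟ fst q))) (map₂ (⌊⌋≡true⁺ (snd p ≟ snd q)))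

  adj-⟨⟩⁻ : ∀ {a b a' b'} → Adj (G □ H) ⟨ a , b ⟩ ⟨ a' , b' ⟩ → AdjCases (a , b) (a' , b')
  adj-⟨⟩⁻ {a} {b} {a'} {b'} =
    subst₂ AdjCases (remQuot-combine {order G} a b) (remQuot-combine {order G} a' b') ∘ adj-□⁻

  adj-⟨⟩⁺ : ∀ {a b a' b'} → AdjCases (a , b) (a' , b') → Adj (G □ H) ⟨ a , b ⟩ ⟨ a' , b' ⟩
  adj-⟨⟩⁺ {a} {b} {a'} {b'} =
    adj-□⁺ ∘ subst₂ AdjCases (sym (remQuot-combine {order G} a b)) (sym (remQuot-combine {order G} a' b'))

  stepˡ : ∀ {a a'} b → Adj G a a' → Adj (G □ H) ⟨ a , b ⟩ ⟨ a' , b ⟩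
  stepˡ b aa' = adj-⟨⟩⁺ (inj₂ (aa' , refl))

  stepʳ : ∀ a {b b'} → Adj H b b' → Adj (G □ H) ⟨ a , b ⟩ ⟨ a , b' ⟩
  stepʳ a bb' = adj-⟨⟩⁺ (inj₁ (refl , bb'))

  liftˡ : ∀ {a a'} → Steps G a a' ℓ → ∀ b → Steps (G □ H) ⟨ a , b ⟩ ⟨ a' , b ⟩ ℓ
  liftˡ ε       b = ε
  liftˡ (e ◅ g) b = stepˡ b e ◅ liftˡ g b

  liftʳ : ∀ a {b b'} → Steps H b b' ℓ → Steps (G □ H) ⟨ a , b ⟩ ⟨ a , b' ⟩ ℓ
  liftʳ a ε       = ε
  liftʳ a (e ◅ h) = stepʳ a e ◅ liftʳ a h

  module _ {Q : Vertex (G □ H) → Set} where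

    allButLast-liftˡ : ∀ {a a'} (g : Steps G a a' ℓ) b →
                       AllButLast (λ x → Q ⟨ x , b ⟩) g → AllButLast Q (liftˡ g b)
    allButLast-liftˡ ε       b _        = tt
    allButLast-liftˡ (_ ◅ g) b (q , qs) = q , allButLast-liftˡ g b qs

    allButLast-liftʳ : ∀ a {b b'} (h : Steps H b b' ℓ) →
                       AllButLast (λ y → Q ⟨ a , y ⟩) h → AllButLast Q (liftʳ a h)
    allButLast-liftʳ a ε       _        = tt
    allButLast-liftʳ a (_ ◅ h) (q , qs) = q , allButLast-liftʳ a h qs

    interior-liftˡ : ∀ {a a'} (g : Steps G a a' ℓ) b → Interior (λ x → Q ⟨ x , b ⟩) g → Interior Q (liftˡ g b)
    interior-liftˡ ε       b _  = tt
    interior-liftˡ (_ ◅ g) b qs = allButLast-liftˡ g b qs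

    interior-liftʳ : ∀ a {b b'} (h : Steps H b b' ℓ) → Interior (λ y → Q ⟨ a , y ⟩) h → Interior Q (liftʳ a h)
    interior-liftʳ a ε       _  = tt
    interior-liftʳ a (_ ◅ h) qs = allButLast-liftʳ a h qs

  Shadows : Vertex G × Vertex H → Vertex G × Vertex H → ℕ → Set
  Shadows (a , b) (a' , b') m = ∃₂ λ i j → i + j ≡ m × Steps G a a' i × Steps H b b' j

  project : ∀ {p q} → Steps (G □ H) p q m → Shadows (split p) (split q) m
  project ε = 0 , 0 , refl , ε , ε
  project (e ◅ w) with project w | adj-□⁻ e
  ... | i , j , refl , g , h | inj₁ (same , b) =
    i , suc j , +-suc i j , subst (λ x → Steps G x _ i) (sym same) g , b ◅ h
  ... | i , j , refl , g , h | inj₂ (a , same) =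
    suc i , j , refl , a ◅ g , subst (λ y → Steps H y _ j) (sym same) h

  project-⟨⟩ : ∀ {a b a' b'} → Steps (G □ H) ⟨ a , b ⟩ ⟨ a' , b' ⟩ m → Shadows (a , b) (a' , b') m
  project-⟨⟩ {a = a} {b} {a'} {b'} w =
    subst₂ (λ r r' → Shadows r r' _) (remQuot-combine {order G} a b) (remQuot-combine {order G} a' b') (project w)

  geodesic-□ : ∀ {x₁ y₁ x₂ y₂ ℓ₁ ℓ₂} (g : Steps G x₁ y₁ ℓ₁) (h : Steps H x₂ y₂ ℓ₂) →
               Geodesic G g → Geodesic H h →
               (w : Steps (G □ H) ⟨ x₁ , x₂ ⟩ ⟨ y₁ , y₂ ⟩ m) → m ≡ ℓ₁ + ℓ₂ → Geodesic (G □ H) w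
  geodesic-□ {x₁ = x₁} {y₁} {x₂} {y₂} g h geo-g geo-h w refl k<m v
    with project-⟨⟩ {a = x₁} {x₂} {y₁} {y₂} v
  ... | i , j , refl , g' , h' = <⇒≱ k<m (+-mono-≤ (geodesic-≤ g geo-g g') (geodesic-≤ h geo-h h'))

  uniqueMiddle-liftˡ : ∀ {a} b → UniqueMiddle G a → UniqueMiddle (G □ H) ⟨ a , b ⟩
  uniqueMiddle-liftˡ {a} b (u , w , u≢w , ¬uw , ua , aw , unique) =
    ⟨ u , b ⟩ , ⟨ w , b ⟩ , u≢w ∘ proj₁ ∘ combine-injective u b w b , ¬adj ∘ adj-⟨⟩⁻ , stepˡ b ua , stepˡ b aw ,
    by-components {P = λ c → Adj (G □ H) ⟨ u , b ⟩ c → Adj (G □ H) c ⟨ w , b ⟩ → c ≡ ⟨ a , b ⟩} unique′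
    where
    ¬adj : ¬ AdjCases (u , b) (w , b)
    ¬adj (inj₁ (u≡w , _)) = u≢w u≡w
    ¬adj (inj₂ (uw , _))  = ¬uw uw

    unique′ : ∀ c₁ c₂ → Adj (G □ H) ⟨ u , b ⟩ ⟨ c₁ , c₂ ⟩ → Adj (G □ H) ⟨ c₁ , c₂ ⟩ ⟨ w , b ⟩ →
              ⟨ c₁ , c₂ ⟩ ≡ ⟨ a , b ⟩
    unique′ c₁ c₂ uc cw with adj-⟨⟩⁻ uc | adj-⟨⟩⁻ cw
    ... | inj₁ (refl , _)   | inj₁ (refl , _)  = ⊥-elim (u≢w refl)
    ... | inj₁ (refl , _)   | inj₂ (uw , _)    = ⊥-elim (¬uw uw)
    ... | inj₂ (uw , refl)  | inj₁ (refl , _)  = ⊥-elim (¬uw uw)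
    ... | inj₂ (uc₁ , refl) | inj₂ (c₁w , _)   = cong (λ x → ⟨ x , b ⟩) (unique c₁ uc₁ c₁w)

  uniqueMiddle-liftʳ : ∀ a {b} → UniqueMiddle H b → UniqueMiddle (G □ H) ⟨ a , b ⟩
  uniqueMiddle-liftʳ a {b} (u , w , u≢w , ¬uw , ub , bw , unique) =
    ⟨ a , u ⟩ , ⟨ a , w ⟩ , u≢w ∘ proj₂ ∘ combine-injective a u a w , ¬adj ∘ adj-⟨⟩⁻ , stepʳ a ub , stepʳ a bw ,
    by-components {P = λ c → Adj (G □ H) ⟨ a , u ⟩ c → Adj (G □ H) c ⟨ a , w ⟩ → c ≡ ⟨ a , b ⟩} unique′
    where
    ¬adj : ¬ AdjCases (a , u) (a , w)
    ¬adj (inj₁ (_ , uw))  = ¬uw uw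
    ¬adj (inj₂ (_ , u≡w)) = u≢w u≡w

    unique′ : ∀ c₁ c₂ → Adj (G □ H) ⟨ a , u ⟩ ⟨ c₁ , c₂ ⟩ → Adj (G □ H) ⟨ c₁ , c₂ ⟩ ⟨ a , w ⟩ →
              ⟨ c₁ , c₂ ⟩ ≡ ⟨ a , b ⟩
    unique′ c₁ c₂ uc cw with adj-⟨⟩⁻ uc | adj-⟨⟩⁻ cw
    ... | inj₂ (_ , refl)   | inj₂ (_ , refl)  = ⊥-elim (u≢w refl)
    ... | inj₂ (_ , refl)   | inj₁ (_ , uw)    = ⊥-elim (¬uw uw)
    ... | inj₁ (refl , uw)  | inj₂ (_ , refl)  = ⊥-elim (¬uw uw)
    ... | inj₁ (refl , uc₂) | inj₁ (_ , c₂w)   = cong (λ y → ⟨ a , y ⟩) (unique c₂ uc₂ c₂w)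

  _⊗_ : (Vertex G → Bool) → (Vertex H → Bool) → Vertex (G □ H) → Bool
  (S ⊗ T) p = S (fst p) ∧ T (snd p)

  module _ {S : Vertex G → Bool} {T : Vertex H → Bool} where

    ⊗-⟨⟩ : ∀ a b → (S ⊗ T) ⟨ a , b ⟩ ≡ S a ∧ T b
    ⊗-⟨⟩ a b = cong (uncurry λ x y → S x ∧ T y) (remQuot-combine {order G} a b)

    ⊗-outsideˡ : ∀ a b → Outside S a → Outside (S ⊗ T) ⟨ a , b ⟩
    ⊗-outsideˡ a b out = trans (⊗-⟨⟩ a b) (cong (_∧ T b) out)

    ⊗-outsideʳ : ∀ a b → Outside T b → Outside (S ⊗ T) ⟨ a , b ⟩
    ⊗-outsideʳ a b out = trans (⊗-⟨⟩ a b) (trans (cong (S a ∧_) out) (∧-zeroʳ (S a)))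

    countF-⊗ : countF (S ⊗ T) ≡ countF S * countF T
    countF-⊗ = countF-combine (order G) (order H) S T ⊗-⟨⟩

    module _ (tight-G : Tight G S) (tight-H : Tight H T) where

      private
        Visible⊗ : Vertex (G □ H) → Vertex (G □ H) → Set
        Visible⊗ = Visibleˢ (G □ H) (Outside (S ⊗ T))

      -- Step off x₁ to z, run along h over z, then finish along g: every inner vertex lies
      -- over z or over an inner vertex of a ◅ g.
      turnˡ : ∀ {x₁ z y₁ x₂ y₂ ℓ₁ ℓ₂} (a : Adj G x₁ z) (g : Steps G z y₁ ℓ₁) (h : Steps H x₂ y₂ ℓ₂) →
              Geodesic G (a ◅ g) → Geodesic H h → Outside S z → AllButLast (Outside S) g →
              Visible⊗ ⟨ x₁ , x₂ ⟩ ⟨ y₁ , y₂ ⟩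
      turnˡ {x₁} {z} {y₁} {x₂} {y₂} {ℓ₁} {ℓ₂} a g h geo-g geo-h out-z out-g =
        _ , w , geodesic-□ (a ◅ g) h geo-g geo-h w (cong suc (+-comm ℓ₂ ℓ₁)) ,
        allButLast-◅◅ (liftʳ z h) (liftˡ g y₂)
          (allButLast-liftʳ z h (allButLast-all (λ y → ⊗-outsideˡ z y out-z) h))
          (allButLast-liftˡ g y₂ (allButLast-map (λ x → ⊗-outsideˡ x y₂) g out-g))
        where
        w : Steps (G □ H) ⟨ x₁ , x₂ ⟩ ⟨ y₁ , y₂ ⟩ (suc (ℓ₂ + ℓ₁))
        w = stepˡ x₂ a ◅ (liftʳ z h ◅◅ liftˡ g y₂)

      turnʳ : ∀ {x₁ y₁ x₂ z y₂ ℓ₁ ℓ₂} (g : Steps G x₁ y₁ ℓ₁) (b : Adj H x₂ z) (h : Steps H z y₂ ℓ₂) →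
              Geodesic G g → Geodesic H (b ◅ h) → Outside T z → AllButLast (Outside T) h →
              Visible⊗ ⟨ x₁ , x₂ ⟩ ⟨ y₁ , y₂ ⟩
      turnʳ {x₁} {y₁} {x₂} {z} {y₂} {ℓ₁} {ℓ₂} g b h geo-g geo-h out-z out-h =
        _ , w , geodesic-□ g (b ◅ h) geo-g geo-h w (sym (+-suc ℓ₁ ℓ₂)) ,
        allButLast-◅◅ (liftˡ g z) (liftʳ y₁ h)
          (allButLast-liftˡ g z (allButLast-all (λ x → ⊗-outsideʳ x z out-z) g))
          (allButLast-liftʳ y₁ h (allButLast-map (⊗-outsideʳ y₁) h out-h))
        where
        w : Steps (G □ H) ⟨ x₁ , x₂ ⟩ ⟨ y₁ , y₂ ⟩ (suc (ℓ₁ + ℓ₂))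
        w = stepʳ x₁ b ◅ (liftˡ g z ◅◅ liftʳ y₁ h)

      -- Of the two corners ⟨ x₁ , y₂ ⟩ and ⟨ y₁ , x₂ ⟩ one is outside S ⊗ T, as x₁ and y₁ are not both in S.
      corner : ∀ {x₁ y₁ x₂ y₂} (a : Adj G x₁ y₁) (b : Adj H x₂ y₂) →
               Geodesic G (a ◅ ε) → Geodesic H (b ◅ ε) → Visible⊗ ⟨ x₁ , x₂ ⟩ ⟨ y₁ , y₂ ⟩
      corner {x₁} {y₁} {x₂} {y₂} a b geo-g geo-h with S x₁ in Sx₁ | S y₁ in Sy₁
      ... | false | _     = 2 , w , geodesic-□ (a ◅ ε) (b ◅ ε) geo-g geo-h w refl , ⊗-outsideˡ x₁ y₂ Sx₁ , tt
        where
        w : Steps (G □ H) ⟨ x₁ , x₂ ⟩ ⟨ y₁ , y₂ ⟩ 2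
        w = stepʳ x₁ b ◅ stepˡ y₂ a ◅ ε
      ... | true  | false = turnˡ a ε (b ◅ ε) geo-g geo-h Sy₁ tt
      ... | true  | true  = ⊥-elim (independent tight-G a Sx₁ Sy₁)

      visible-⟨⟩ : ∀ x₁ x₂ y₁ y₂ → Visible⊗ ⟨ x₁ , x₂ ⟩ ⟨ y₁ , y₂ ⟩
      visible-⟨⟩ x₁ x₂ y₁ y₂ with visible tight-G x₁ y₁ | visible tight-H x₂ y₂
      ... | _ , ε , _ , _ | ℓ₂ , h , geo-h , out-h =
        ℓ₂ , liftʳ x₁ h , geodesic-□ ε h (λ ()) geo-h (liftʳ x₁ h) refl ,
        interior-liftʳ x₁ h (interior-map (⊗-outsideʳ x₁) h out-h)
      ... | ℓ₁ , g , geo-g , out-g | _ , ε , _ , _ =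
        ℓ₁ , liftˡ g x₂ , geodesic-□ g ε geo-g (λ ()) (liftˡ g x₂) (sym (+-identityʳ ℓ₁)) ,
        interior-liftˡ g x₂ (interior-map (λ x → ⊗-outsideˡ x x₂) g out-g)
      ... | _ , a ◅ g@(_ ◅ _) , geo-g , out-g | _ , h , geo-h , _ = turnˡ a g h geo-g geo-h (proj₁ out-g) out-g
      ... | _ , g , geo-g , _ | _ , b ◅ h@(_ ◅ _) , geo-h , out-h = turnʳ g b h geo-g geo-h (proj₁ out-h) out-h
      ... | _ , a ◅ ε , geo-g , _ | _ , b ◅ ε , geo-h , _ = corner a b geo-g geo-h

      independent-⟨⟩ : ∀ a b a' b' → Adj (G □ H) ⟨ a , b ⟩ ⟨ a' , b' ⟩ →
                       (S ⊗ T) ⟨ a , b ⟩ ≡ true → (S ⊗ T) ⟨ a' , b' ⟩ ≡ true → ⊥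
      independent-⟨⟩ a b a' b' e in₁ in₂
        with adj-⟨⟩⁻ e | trans (sym (⊗-⟨⟩ a b)) in₁ | trans (sym (⊗-⟨⟩ a' b')) in₂
      ... | inj₁ (refl , bb') | i₁ | i₂ = independent tight-H bb' (∧-conicalʳ _ _ i₁) (∧-conicalʳ _ _ i₂)
      ... | inj₂ (aa' , refl) | i₁ | i₂ = independent tight-G aa' (∧-conicalˡ _ _ i₁) (∧-conicalˡ _ _ i₂)

      middle-⟨⟩ : ∀ a b → Outside (S ⊗ T) ⟨ a , b ⟩ → UniqueMiddle (G □ H) ⟨ a , b ⟩
      middle-⟨⟩ a b out with S a in Sa | trans (sym (⊗-⟨⟩ a b)) out
      ... | false | _  = uniqueMiddle-liftˡ b (middle tight-G Sa)
      ... | true  | Tb = uniqueMiddle-liftʳ a (middle tight-H Tb)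

      tight-□ : Tight (G □ H) (S ⊗ T)
      tight-□ = record
        { visible     = λ p q → by-components (λ x₁ x₂ → by-components (visible-⟨⟩ x₁ x₂) q) p
        ; independent = λ {p} {q} → by-components (λ a b → by-components (independent-⟨⟩ a b) q) p
        ; middle      = λ {v} → by-components middle-⟨⟩ v
        }

cycle : ∀ {x m} (w : Steps G x x m) → 3 ≤ m → Unique (departures w) → HasCycle G
cycle {x = x} {m = m} w 3≤m distinct = x , m , toWalk w , 3≤m , λ i j same →
  lookup-injective distinct i j (trans (sym (lookup-departures w i)) (trans same (lookup-departures w j)))

fresh : ∀ {n} → 3 ≤ n → (a b : Fin n) → ∃ λ c → c ≢ a × c ≢ b
fresh (s≤s (s≤s (s≤s _))) a b with zero ≟ a | zero ≟ b | suc zero ≟ a | suc zero ≟ b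
... | no 0≢a   | no 0≢b   | _        | _        = zero , 0≢a , 0≢b
... | _        | _        | no 1≢a   | no 1≢b   = suc zero , 1≢a , 1≢b
... | yes refl | _        | _        | yes refl = suc (suc zero) , (λ ()) , (λ ())
... | _        | yes refl | yes refl | _        = suc (suc zero) , (λ ()) , (λ ())
... | yes refl | _        | yes ()   | _
... | _        | yes refl | _        | yes ()

isLeaf : (G : Graph) → Vertex G → Bool
isLeaf G v = degree G v ≡ᵇ 1

≥2⇒≢ᵇ1 : ∀ {d} → 2 ≤ d → (d ≡ᵇ 1) ≡ false
≥2⇒≢ᵇ1 (s≤s (s≤s _)) = refl

≢ᵇ1⇒≥2 : ∀ {d} → 1 ≤ d → (d ≡ᵇ 1) ≡ false → 2 ≤ d
≢ᵇ1⇒≥2 {suc (suc _)} _ _ = s≤s (s≤s z≤n)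

module _ {G : Graph} (simple : IsSimple G) where

  adj-sym : ∀ {u v} → Adj G u v → Adj G v u
  adj-sym {u} {v} = trans (proj₁ simple v u)

  adj⇒≢ : ∀ {u v} → Adj G u v → u ≢ v
  adj⇒≢ {u} uv refl with () ← trans (sym uv) (proj₂ simple u)

  two-neighbours⇒nonleaf : ∀ {v p q} → Adj G v p → Adj G v q → p ≢ q → Outside (isLeaf G) v
  two-neighbours⇒nonleaf {v} vp vq p≢q = ≥2⇒≢ᵇ1 (countF-≥2 (adj G v) p≢q vp vq)

  geodesic-nonleaf : ∀ {x y} (w : Steps G x y ℓ) → Geodesic G w → Interior (Outside (isLeaf G)) w
  geodesic-nonleaf ε       _   = tt
  geodesic-nonleaf (a ◅ w) geo = arrivals-nonleaf a w geo
    where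
    arrivals-nonleaf : ∀ {p z y ℓ} (a : Adj G p z) (w : Steps G z y ℓ) → Geodesic G (a ◅ w) →
                       AllButLast (Outside (isLeaf G)) w
    arrivals-nonleaf a ε       _   = tt
    arrivals-nonleaf a (b ◅ w) geo =
      two-neighbours⇒nonleaf (adj-sym a) b (λ { refl → geo (s≤s (n≤1+n _)) w }) ,
      arrivals-nonleaf b w (geodesic-tail a (b ◅ w) geo)

  leaves-visible : Connected G → ∀ x y → Visibleˢ G (Outside (isLeaf G)) x y
  leaves-visible connected x y with geodesic (fromWalk (proj₂ (connected x y)))
  ... | ℓ , w , geo = ℓ , w , geo , geodesic-nonleaf w geo

module Tree (T : Graph) (tree : IsTree T) (3≤order : 3 ≤ order T) where

  simple : IsSimple T
  simple = proj₁ tree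

  connected : Connected T
  connected = proj₁ (proj₂ tree)

  acyclic : ¬ HasCycle T
  acyclic = proj₂ (proj₂ tree)

  no-triangle : ∀ {a b c} → Adj T a b → Adj T b c → Adj T c a → a ≢ b → a ≢ c → b ≢ c → ⊥
  no-triangle ab bc ca a≢b a≢c b≢c =
    acyclic (cycle (ab ◅ bc ◅ ca ◅ ε) (s≤s (s≤s (s≤s z≤n))) ((a≢b ∷ a≢c ∷ []) ∷ (b≢c ∷ []) ∷ [] ∷ []))

  no-square : ∀ {a b c d} → Adj T a b → Adj T b c → Adj T c d → Adj T d a →
              a ≢ b → a ≢ c → a ≢ d → b ≢ c → b ≢ d → c ≢ d → ⊥
  no-square ab bc cd da a≢b a≢c a≢d b≢c b≢d c≢d =
    acyclic (cycle (ab ◅ bc ◅ cd ◅ da ◅ ε) (s≤s (s≤s (s≤s z≤n)))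
                   ((a≢b ∷ a≢c ∷ a≢d ∷ []) ∷ (b≢c ∷ b≢d ∷ []) ∷ (c≢d ∷ []) ∷ [] ∷ []))

  degree≥1 : ∀ v → 1 ≤ degree T v
  degree≥1 v with fresh 3≤order v v
  ... | u , u≢v , _ with connected v u
  ...   | _ , walk with fromWalk walk
  ...     | ε     = ⊥-elim (u≢v refl)
  ...     | a ◅ _ = countF-≥1 (adj T v) a

  nonleaf-middle : ∀ {v} → Outside (isLeaf T) v → UniqueMiddle T v
  nonleaf-middle {v} nonleaf with countF≥2⇒∃₂ (adj T v) (≢ᵇ1⇒≥2 (degree≥1 v) nonleaf)
  ... | u , w , u≢w , vu , vw = u , w , u≢w , ¬uw , adj-sym simple vu , vw , unique
    where
    ¬uw : ¬ Adj T u w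
    ¬uw uw = no-triangle vu uw (adj-sym simple vw) (adj⇒≢ simple vu) (adj⇒≢ simple vw) u≢w

    unique : ∀ c → Adj T u c → Adj T c w → c ≡ v
    unique c uc cw with c ≟ v
    ... | yes c≡v = c≡v
    ... | no  c≢v = ⊥-elim (no-square vu uc cw (adj-sym simple vw)
                              (adj⇒≢ simple vu) (c≢v ∘ sym) (adj⇒≢ simple vw)
                              (adj⇒≢ simple uc) u≢w (adj⇒≢ simple cw))

  leaf-neighbour-unique : ∀ {x y c} → isLeaf T x ≡ true → Adj T x y → Adj T x c → c ≡ y
  leaf-neighbour-unique {x} leaf xy xc =
    countF≡1⇒unique (adj T x) (≡ᵇ⇒≡ (degree T x) 1 (Equivalence.from T-≡ leaf)) xc xy

  leaves-independent : ∀ {x y} → Adj T x y → isLeaf T x ≡ true → isLeaf T y ≡ true → ⊥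
  leaves-independent {x} {y} xy leaf-x leaf-y with fresh 3≤order x y
  ... | z , z≢x , z≢y = [ z≢x , z≢y ]′ (trapped (fromWalk (proj₂ (connected x z))) (inj₁ refl))
    where
    trapped : ∀ {u v} → Steps T u v m → u ≡ x ⊎ u ≡ y → v ≡ x ⊎ v ≡ y
    trapped ε       here        = here
    trapped (a ◅ w) (inj₁ refl) = trapped w (inj₂ (leaf-neighbour-unique leaf-x xy a))
    trapped (a ◅ w) (inj₂ refl) = trapped w (inj₁ (leaf-neighbour-unique leaf-y (adj-sym simple xy) a))

  tight : Tight T (isLeaf T)
  tight = record
    { visible     = leaves-visible simple connected
    ; independent = leaves-independent
    ; middle      = nonleaf-middle
    }

tight-□-all : ∀ {k} (Ts : Vec Graph (suc k)) → (∀ i → IsTree (lookup Ts i) × 3 ≤ order (lookup Ts i)) →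
              ∃ λ S → Tight (□-all Ts) S × countF S ≡ prod (map n₁ Ts)
tight-□-all (G ∷ []) trees =
  isLeaf G , Tree.tight G (proj₁ (trees zero)) (proj₂ (trees zero)) , sym (*-identityʳ (n₁ G))
tight-□-all (G ∷ Gs@(_ ∷ _)) trees with tight-□-all Gs (trees ∘ suc)
... | S , tight , count =
  isLeaf G ⊗ S , tight-□ (Tree.tight G (proj₁ (trees zero)) (proj₂ (trees zero))) tight ,
  trans (countF-⊗ {isLeaf G} {S}) (cong (n₁ G *_) count)
  where open Product G (□-all Gs)

corollary5p7 : ∀ (k : ℕ) (T : Vec Graph (suc k)) → (∀ (i : Fin (suc k)) → IsTree (lookup T i) × 3 ≤ order (lookup T i)) → μt≡ (□-all T) (prod (map n₁ T))
corollary5p7 k T trees with tight-□-all T trees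
... | S , tight , count = subst (μt≡ (□-all T)) count (tight⇒μt≡ tight)
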